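{- Let $G$ be a finite graph with vertices ordered $v_1,\ldots,v_n$. For each $i$, let $A(v_i)=N(v_i)\cap\{v_1,\dots,v_{i-1}\}$ be the set of neighbors of $v_i$ that precede it in the ordering. Define $t_1,\dots,t_n$ recursively by \[ t_i = 1+\prod_{v_j\in A(v_i)} t_j, \] where the empty product equals $1$. Then $\mathrm{HG}(G) < \max\{t_1,\ldots,t_n\}$.
   Context: Hat guessing game: players sit on the vertices of a finite simple graph $G$; an adversary places on each vertex a hat of one of $q$ colors. Each player sees only the hat colors of its neighbors (not its own) and, following a strategy agreed in advance (a deterministic function of the colors it sees), guesses its own hat color; all guess simultaneously. The players win if at least one player guesses correctly. The hat guessing number $\mathrm{HG}(G)$ is the largest $q$ for which the players have a strategy that wins for every hat assignment with $q$ colors. -}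

module Defs where

open import Data.Nat using (ℕ; suc; _<ᵇ_; _⊔_)
open import Data.Nat.ListAction using (product)
open import Data.Fin using (Fin; toℕ)
open import Data.Bool using (Bool; true; false; _∧_; if_then_else_)
open import Data.List using (List; map; foldr; allFin)
open import Data.Product using (∃)
open import Relation.Binary.PropositionalEquality using (_≡_)

-- A finite simple graph on the vertex set Fin n (vertex v_{i+1} is the
-- element i of Fin n; the ordering v_1,...,v_n is the natural order of Fin n).
record SimpleGraph (n : ℕ) : Set where
  field
    adj    : Fin n → Fin n → Bool
    sym    : ∀ u v → adj u v ≡ adj v u
    irrefl : ∀ v → adj v v ≡ false
open SimpleGraph public

Coloring : ℕ → ℕ → Set
Coloring n q = Fin n → Fin q

record Strategy {n : ℕ} (G : SimpleGraph n) (q : ℕ) : Set where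
  field
    guess : Fin n → Coloring n q → Fin q
    local : ∀ v (c c′ : Coloring n q) →
            (∀ u → adj G v u ≡ true → c u ≡ c′ u) →
            guess v c ≡ guess v c′
open Strategy public

Winning : ∀ {n q} {G : SimpleGraph n} → Strategy G q → Set
Winning {n} {q} S = ∀ (c : Coloring n q) → ∃ λ v → guess S v c ≡ c v

HatWin : ∀ {n} → SimpleGraph n → ℕ → Set
HatWin G q = ∃ λ (S : Strategy G q) → Winning S

prodEarlier : ∀ {n} → SimpleGraph n → (Fin n → ℕ) → Fin n → ℕ
prodEarlier {n} G t i =
  product (map (λ j → if adj G i j ∧ (toℕ j <ᵇ toℕ i) then t j else 1) (allFin n))

IsTSeq : ∀ {n} → SimpleGraph n → (Fin n → ℕ) → Set
IsTSeq G t = ∀ i → t i ≡ suc (prodEarlier G t i)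

maxVal : ∀ {n} → (Fin n → ℕ) → ℕ
maxVal {n} t = foldr _⊔_ 0 (map t (allFin n))

-- If every t_i were at most q, the adversary could defeat any strategy by
-- colouring v_n, v_{n-1}, …, v_1 in turn, giving v_i a colour below t_i.  When v_i
-- is coloured, its later neighbours are already fixed, and each earlier neighbour
-- v_j will receive one of t_j colours, so v_i's guess takes at most ∏_{A(v_i)} t_j
-- = t_i - 1 values; one of the t_i colours below t_i is never guessed by v_i.
module Submission where

open import Defs hiding (sym)
open import Data.Nat using (ℕ; zero; suc; _+_; _*_; _<_; _≤_; _<ᵇ_)
open import Data.Nat.Properties
  using (≤-refl; ≤-reflexive; module ≤-Reasoning; <⇒≤; <-irrefl; n<1+n; ≰⇒>; m<1+n⇒m<n∨m≡n;
         m⊔n≤o⇒m≤o; m⊔n≤o⇒n≤o; <ᵇ⇒<; <⇒<ᵇ; <-cmp)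
open import Data.Nat.ListAction using (product)
open import Data.Fin using (Fin; toℕ; fromℕ<; inject≤; _≟_)
import Data.Fin as Fin
open import Data.Fin.Properties
  using (toℕ-injective; toℕ-fromℕ<; toℕ-inject≤; toℕ<n; inject≤-injective; ¬∀⟶∃¬; pigeonhole)
  renaming (<-irrefl to <-irreflᶠ)
open import Data.Bool using (Bool; true; false; _∧_; if_then_else_; T)
open import Data.List using (List; []; _∷_; _++_; map; length; tabulate; allFin; cartesianProductWith)
open import Data.List.Properties using (length-map; length-tabulate; length-++; map-tabulate; tabulate-cong; foldr-forcesᵇ)
import Data.List.Relation.Unary.Any as Any
open import Data.List.Relation.Unary.Any using (here)
open import Data.List.Relation.Unary.All.Properties using (map⁻; tabulate⁻)
open import Data.List.Membership.Propositional using (_∈_; _∉_)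
open import Data.List.Membership.Propositional.Properties using (∈-map⁺; ∈-allFin; ∈-cartesianProductWith⁺)
open import Data.List.Membership.Setoid.Properties using (index-injective)
import Data.List.Membership.DecPropositional as DecMembership
open import Data.Vec.Functional using (Vector; updateAt) renaming ([] to []ᵛ; _∷_ to _∷ᵛ_)
open import Data.Vec.Functional.Properties using (updateAt-updates; updateAt-minimal)
open import Data.Product using (∃; _×_; _,_; proj₁; proj₂)
open import Data.Sum using (inj₁; inj₂)
open import Data.Empty using (⊥)
open import Data.Unit using (tt)
open import Function using (_∘_; id; const)
open import Relation.Nullary using (¬_; contradiction)
open import Relation.Binary using (tri<; tri≈; tri>)
open import Relation.Binary.PropositionalEquality
  using (_≡_; _≢_; _≗_; refl; sym; trans; cong; cong₂; subst; setoid; module ≡-Reasoning)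

length-cartesianProductWith : ∀ {A B C : Set} (f : A → B → C) xs ys →
  length (cartesianProductWith f xs ys) ≡ length xs * length ys
length-cartesianProductWith f []       ys = refl
length-cartesianProductWith f (x ∷ xs) ys = begin
  length (map (f x) ys ++ cartesianProductWith f xs ys)
    ≡⟨ length-++ (map (f x) ys) ⟩
  length (map (f x) ys) + length (cartesianProductWith f xs ys)
    ≡⟨ cong₂ _+_ (length-map (f x) ys) (length-cartesianProductWith f xs ys) ⟩
  length ys + length xs * length ys ∎
  where open ≡-Reasoning

module _ {A : Set} where

  choices : ∀ {n} → (Fin n → List A) → List (Vector A n)
  choices {zero}  R = []ᵛ ∷ []
  choices {suc n} R = cartesianProductWith _∷ᵛ_ (R Fin.zero) (choices (R ∘ Fin.suc))

  length-choices : ∀ {n} (R : Fin n → List A) → length (choices R) ≡ product (tabulate (length ∘ R))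
  length-choices {zero}  R = refl
  length-choices {suc n} R =
    trans (length-cartesianProductWith _∷ᵛ_ (R Fin.zero) (choices (R ∘ Fin.suc)))
          (cong (length (R Fin.zero) *_) (length-choices (R ∘ Fin.suc)))

  -- Membership holds only up to ≗: without function extensionality we cannot do better.
  ∈-choices : ∀ {n} (R : Fin n → List A) (f : Vector A n) → (∀ i → f i ∈ R i) →
              ∃ λ g → g ∈ choices R × g ≗ f
  ∈-choices {zero}  R f f∈R = []ᵛ , here refl , λ ()
  ∈-choices {suc n} R f f∈R with ∈-choices (R ∘ Fin.suc) (f ∘ Fin.suc) (f∈R ∘ Fin.suc)
  ... | g , g∈ , g≗f = f Fin.zero ∷ᵛ g , ∈-cartesianProductWith⁺ _∷ᵛ_ (f∈R Fin.zero) g∈ , agree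
    where
      agree : f Fin.zero ∷ᵛ g ≗ f
      agree Fin.zero    = refl
      agree (Fin.suc i) = g≗f i

∃-inject≤-∉ : ∀ {m n} (m≤n : m ≤ n) (xs : List (Fin n)) → length xs < m →
              ∃ λ (i : Fin m) → inject≤ i m≤n ∉ xs
∃-inject≤-∉ {m} m≤n xs short = ¬∀⟶∃¬ m _ (λ i → inject≤ i m≤n ∈? xs) all-injected-∉
  where
    open DecMembership _≟_ using (_∈?_)
    all-injected-∉ : ¬ (∀ i → inject≤ i m≤n ∈ xs)
    all-injected-∉ ∈xs with pigeonhole short (λ i → Any.index (∈xs i))
    ... | i , j , i<j , same-index =
      <-irreflᶠ (inject≤-injective m≤n m≤n i j (index-injective (setoid _) (∈xs i) (∈xs j) same-index)) i<j

maxVal≤⇒≤ : ∀ {n q} (t : Fin n → ℕ) → maxVal t ≤ q → ∀ j → t j ≤ q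
maxVal≤⇒≤ {n} t max≤q =
  tabulate⁻ (map⁻ (foldr-forcesᵇ (λ a b ab≤q → m⊔n≤o⇒m≤o a b ab≤q , m⊔n≤o⇒n≤o a b ab≤q)
                                  0 (map t (allFin n)) max≤q))

earlierNeighbour : ∀ {n} → SimpleGraph n → Fin n → Fin n → Bool
earlierNeighbour G k j = adj G k j ∧ (toℕ j <ᵇ toℕ k)

module _ {n} (G : SimpleGraph n) {k j : Fin n} where

  earlierNeighbour⇒< : earlierNeighbour G k j ≡ true → toℕ j < toℕ k
  earlierNeighbour⇒< earlier with adj G k j
  ... | true = <ᵇ⇒< (toℕ j) (toℕ k) (subst T (sym earlier) tt)

  laterNeighbour : adj G k j ≡ true → earlierNeighbour G k j ≡ false → toℕ k < toℕ j
  laterNeighbour adjacent notEarlier with <-cmp (toℕ j) (toℕ k)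
  ... | tri< j<k _ _ =
    contradiction (<⇒<ᵇ j<k) (subst T (trans (cong (_∧ (toℕ j <ᵇ toℕ k)) (sym adjacent)) notEarlier))
  ... | tri≈ _ j≡k _ with toℕ-injective j≡k
  ...   | refl with trans (sym adjacent) (irrefl G k)
  ...     | ()
  laterNeighbour adjacent notEarlier | tri> _ _ k<j = k<j

module Adversary {n q} (G : SimpleGraph n) (S : Strategy G q)
                 (t : Fin n → ℕ) (t≤q : ∀ j → t j ≤ q) where

  palette : Fin n → List (Fin q)
  palette j = map (λ a → inject≤ a (t≤q j)) (allFin (t j))

  length-palette : ∀ j → length (palette j) ≡ t j
  length-palette j = trans (length-map _ (allFin (t j))) (length-tabulate _)

  ∈-palette : ∀ j c → toℕ c < t j → c ∈ palette j
  ∈-palette j c c<t = subst (_∈ palette j) injected≡c (∈-map⁺ _ (∈-allFin (fromℕ< c<t)))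
    where
      injected≡c : inject≤ (fromℕ< c<t) (t≤q j) ≡ c
      injected≡c = toℕ-injective (trans (toℕ-inject≤ (fromℕ< c<t) (t≤q j)) (toℕ-fromℕ< c<t))

  options : Fin n → Coloring n q → Fin n → List (Fin q)
  options k y j = if earlierNeighbour G k j then palette j else y j ∷ []

  candidates : Fin n → Coloring n q → List (Coloring n q)
  candidates k y = choices (options k y)

  length-candidates : ∀ k y → length (candidates k y) ≡ prodEarlier G t k
  length-candidates k y = begin
    length (choices (options k y))            ≡⟨ length-choices (options k y) ⟩
    product (tabulate (length ∘ options k y)) ≡⟨ cong product (tabulate-cong length-options) ⟩
    product (tabulate factor)                 ≡⟨ cong product (sym (map-tabulate id factor)) ⟩
    prodEarlier G t k                         ∎
    where
      open ≡-Reasoning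
      factor : Fin n → ℕ
      factor j = if earlierNeighbour G k j then t j else 1
      length-options : ∀ j → length (options k y j) ≡ factor j
      length-options j with earlierNeighbour G k j
      ... | true  = length-palette j
      ... | false = refl

  restrict : Fin n → Coloring n q → Coloring n q → Coloring n q
  restrict k y z j = if earlierNeighbour G k j then z j else y j

  restrict∈options : ∀ k y z → (∀ j → toℕ j < toℕ k → toℕ (z j) < t j) →
                      ∀ j → restrict k y z j ∈ options k y j
  restrict∈options k y z z<t j with earlierNeighbour G k j in earlier
  ... | true  = ∈-palette j (z j) (z<t j (earlierNeighbour⇒< G earlier))
  ... | false = here refl

  guess-∈-candidates : ∀ k y z → (∀ j → toℕ j < toℕ k → toℕ (z j) < t j) →
                       (∀ j → toℕ k < toℕ j → z j ≡ y j) →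
                       guess S k z ∈ map (guess S k) (candidates k y)
  guess-∈-candidates k y z z<t z≡y with ∈-choices (options k y) (restrict k y z) (restrict∈options k y z z<t)
  ... | c , c∈ , c≗restrict =
    subst (_∈ map (guess S k) (candidates k y)) (local S k c z c≡z) (∈-map⁺ (guess S k) c∈)
    where
      c≡z : ∀ u → adj G k u ≡ true → c u ≡ z u
      c≡z u adjacent with earlierNeighbour G k u in earlier | c≗restrict u
      ... | true  | c≡ = c≡
      ... | false | c≡ = trans c≡ (sym (z≡y u (laterNeighbour G adjacent earlier)))

  unguessedColour : IsTSeq G t → ∀ k y → ∃ λ (a : Fin (t k)) →
    ∀ z → (∀ j → toℕ j < toℕ k → toℕ (z j) < t j) → (∀ j → toℕ k < toℕ j → z j ≡ y j) →
    guess S k z ≢ inject≤ a (t≤q k)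
  unguessedColour ts k y with ∃-inject≤-∉ (t≤q k) guesses fewGuesses
    where
      guesses : List (Fin q)
      guesses = map (guess S k) (candidates k y)
      fewGuesses : length guesses < t k
      fewGuesses = begin-strict
        length guesses                  ≡⟨ length-map (guess S k) (candidates k y) ⟩
        length (candidates k y)         ≡⟨ length-candidates k y ⟩
        prodEarlier G t k               <⟨ n<1+n _ ⟩
        suc (prodEarlier G t k)         ≡⟨ sym (ts k) ⟩
        t k                             ∎
        where open ≤-Reasoning
  ... | a , a∉ = a , λ z z<t z≡y guess≡a →
    a∉ (subst (_∈ map (guess S k) (candidates k y)) guess≡a (guess-∈-candidates k y z z<t z≡y))

  Foiled : ℕ → Coloring n q → Set
  Foiled r x = ∀ j → toℕ j < r → toℕ (x j) < t j × guess S j x ≢ x j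

  foil : IsTSeq G t → ∀ r → r ≤ n → (y : Coloring n q) →
         ∃ λ x → (∀ j → r ≤ toℕ j → x j ≡ y j) × Foiled r x
  foil ts zero    _   y = y , (λ _ _ → refl) , λ _ ()
  foil ts (suc r) r<n y
    with a , a-unguessed ← unguessedColour ts (fromℕ< r<n) y
    with x , x≡y′ , foiled ← foil ts r (<⇒≤ r<n) (updateAt y (fromℕ< r<n) (const (inject≤ a (t≤q _))))
    = x , x≡y , foiledAt
    where
      k : Fin n
      k = fromℕ< r<n
      toℕk : toℕ k ≡ r
      toℕk = toℕ-fromℕ< r<n
      xk : x k ≡ inject≤ a (t≤q k)
      xk = trans (x≡y′ k (≤-reflexive (sym toℕk))) (updateAt-updates k y)
      x≡y : ∀ j → suc r ≤ toℕ j → x j ≡ y j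
      x≡y j r<j = trans (x≡y′ j (<⇒≤ r<j)) (updateAt-minimal j k y j≢k)
        where
          j≢k : j ≢ k
          j≢k j≡k = <-irrefl (trans (sym toℕk) (cong toℕ (sym j≡k))) r<j
      foiledAt : Foiled (suc r) x
      foiledAt j j<1+r with m<1+n⇒m<n∨m≡n j<1+r
      ... | inj₁ j<r = foiled j j<r
      ... | inj₂ j≡r with refl ← toℕ-injective (trans j≡r (sym toℕk)) =
        subst (_< t k) (sym (trans (cong toℕ xk) (toℕ-inject≤ a (t≤q k)))) (toℕ<n a) ,
        λ guess≡ → a-unguessed x (λ i i<k → proj₁ (foiled i (subst (toℕ i <_) toℕk i<k)))
                                 (λ i k<i → x≡y i (subst (_< toℕ i) toℕk k<i))
                                 (trans guess≡ xk)

  foilingColouring : IsTSeq G t → Coloring n q → ∃ λ x → ∀ j → guess S j x ≢ x j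
  foilingColouring ts y with x , _ , foiled ← foil ts n ≤-refl y =
    x , λ j → proj₂ (foiled j (toℕ<n j))

lemma4 : (m : ℕ) (G : SimpleGraph (suc m)) (t : Fin (suc m) → ℕ) →
         IsTSeq G t → (q : ℕ) → HatWin G q → q < maxVal t
lemma4 m G t ts q (S , win) = ≰⇒> (defeated ∘ maxVal≤⇒≤ t)
  where
    defeated : (∀ j → t j ≤ q) → ⊥
    defeated t≤q
      with x , foiled ← Adversary.foilingColouring G S t t≤q ts
                          (λ _ → inject≤ Fin.zero (subst (_≤ q) (ts Fin.zero) (t≤q Fin.zero)))
      = foiled (proj₁ (win x)) (proj₂ (win x))
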